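{- Let $t\geq 3$ and let $\boldsymbol{R}$ be the symmetric $2t$-cycle in $\boldsymbol{H}(t,2)$ given by $R^0=\mathrm{T}^{(+)}$, $R^s={}_{ -[s]}R^0$ for $1\leq s\leq t-1$, and $R^{k+t}=-R^k$ for $0\leq k\leq t-1$. Let $T\in\{1,-1\}^t$ be a vertex of $\boldsymbol{H}(t,2)$ and let $A$ be a proper subset of $E_t=\{1,\ldots,t\}$. \begin{itemize} \item[(i)] If $|\{1,t\}\cap A|=1$, then $|\boldsymbol{Q}(T,\boldsymbol{R})|=|\boldsymbol{Q}({}_{ -A}T,\boldsymbol{R})|$ if and only if $\sum_{i\in[t-1]:\ |\{i,i+1\}\cap A|=1} T(i)\,T(i+1)=T(1)\,T(t)$. \item[(ii)] If $|\{1,t\}\cap A|\neq 1$, then $|\boldsymbol{Q}(T,\boldsymbol{R})|=|\boldsymbol{Q}({}_{ -A}T,\boldsymbol{R})|$ if and only if $\sum_{i\in[t-1]:\ |\{i,i+1\}\cap A|=1} T(i)\,T(i+1)=0$. \end{itemize}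
   Context: Let $t\geq 3$ be an integer, $E_t=[t]=\{1,\ldots,t\}$, and $[a,b]=\{a,\ldots,b\}$ for integers $a\leq b$. The hypercube graph $\boldsymbol{H}(t,2)$ has vertex set $\{1,-1\}^t$ (topes), row vectors $T=(T(1),\ldots,T(t))$; vertices are adjacent iff they differ in exactly one coordinate. $\mathrm{T}^{(+)}=(1,\ldots,1)$. For $A\subseteq E_t$, ${}_{ -A}T$ is obtained from $T$ by negating the coordinates indexed by $A$. Let $\mathbf{M}$ be the (nonsingular) $t\times t$ matrix with rows $R^0,\ldots,R^{t-1}$, and $\boldsymbol{x}(T,\boldsymbol{R})=T\mathbf{M}^{ -1}\in\{ -1,0,1\}^t$. $\boldsymbol{Q}(T,\boldsymbol{R})$ is the unique inclusion-minimal subset of the vertex set of $\boldsymbol{R}$ whose sum is $T$ (known to exist and be unique); equivalently $\boldsymbol{Q}(T,\boldsymbol{R})=\{x_iR^{i-1}\colon x_i\neq 0\}$ for $(x_1,\ldots,x_t)=\boldsymbol{x}(T,\boldsymbol{R})$, so $|\boldsymbol{Q}(T,\boldsymbol{R})|$ is the number of nonzero entries of $\boldsymbol{x}(T,\boldsymbol{R})$. -}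

module Defs where

open import Data.Nat using (ℕ; zero; suc; _+_)
open import Data.Bool using (Bool; true; false; if_then_else_)
open import Data.Fin using (Fin; zero; suc; toℕ; inject₁; fromℕ; _<_)
open import Data.Fin.Properties using (_<?_)
open import Data.Integer using (ℤ; +_; -_; -[1+_]) renaming (_+_ to _+ℤ_; _*_ to _*ℤ_)
open import Data.Product using (_×_)
open import Data.Sum using (_⊎_)
open import Relation.Nullary using (does)
open import Relation.Binary.PropositionalEquality using (_≡_)

-- Vectors of length t are functions Fin t → ℤ; coordinate i ∈ E_t = {1,…,t}
-- corresponds to the index (i-1) : Fin t.

Σℤ : ∀ {n} → (Fin n → ℤ) → ℤ
Σℤ {zero}  f = + 0
Σℤ {suc n} f = f zero +ℤ Σℤ (λ i → f (suc i))

IsTope : ∀ {t} → (Fin t → ℤ) → Set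
IsTope T = ∀ i → (T i ≡ + 1) ⊎ (T i ≡ -[1+ 0 ])

Subset : ℕ → Set
Subset t = Fin t → Bool

negOn : ∀ {t} → Subset t → (Fin t → ℤ) → (Fin t → ℤ)
negOn A T i = if A i then - T i else T i

Tplus : ∀ {t} → Fin t → ℤ
Tplus _ = + 1

-- R^s = {}_{-[s]} R^0 for 0 ≤ s ≤ t-1 (R^0 = T^{(+)}):
-- coordinate j+1 (index j) is negated iff j+1 ≤ s, i.e. j < s.
-- These are the rows R^0,…,R^{t-1} of the matrix M; R^{k+t} = -R^k.
Rrow : ∀ {t} → Fin t → (Fin t → ℤ)
Rrow s = negOn (λ j → does (j <? s)) Tplus

Rcycle : ∀ {t} → (k : Fin t) → Bool → (Fin t → ℤ)
Rcycle k false = Rrow k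
Rcycle k true  = λ j → - Rrow k j

-- x is the coordinate vector of T w.r.t. M, i.e. x M = T (x = T M⁻¹).
IsCoordVec : ∀ {t} → (Fin t → ℤ) → (Fin t → ℤ) → Set
IsCoordVec T x = ∀ j → T j ≡ Σℤ (λ s → x s *ℤ Rrow s j)

-- number of nonzero entries = |Q(T,R)| when x = x(T,R)
nz : ℤ → ℕ
nz (+ zero) = 0
nz _        = 1

countNonzero : ∀ {t} → (Fin t → ℤ) → ℕ
countNonzero {zero}  x = 0
countNonzero {suc n} x = nz (x zero) + countNonzero (λ i → x (suc i))

b2n : Bool → ℕ
b2n true  = 1
b2n false = 0

endCount : ∀ {n} → Subset (suc n) → ℕ
endCount {n} A = b2n (A zero) + b2n (A (fromℕ n))

-- |{i,i+1} ∩ A| for i ∈ [t-1], indexed by i' : Fin n (i = i'+1)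
pairCount : ∀ {n} → Subset (suc n) → Fin n → ℕ
pairCount A i = b2n (A (inject₁ i)) + b2n (A (suc i))

boundarySum : ∀ {n} → Subset (suc n) → (Fin (suc n) → ℤ) → ℤ
boundarySum A T = Σℤ (λ i → sel (pairCount A i) (T (inject₁ i) *ℤ T (suc i)))
  where
  sel : ℕ → ℤ → ℤ
  sel 1 z = z
  sel _ _ = + 0

module Submission where

-- Write T = x M with the rows R^s = {}_{-[s]} T^{(+)} of M.
-- Since R^s is -1 exactly on the first s coordinates,
--   T(1) = x₀ - (x₁ + … + x_{t-1}),   T(t) = x₀ + … + x_{t-1},
--   T(j+1) = T(j) + 2·x_j                (1 ≤ j ≤ t-1).
-- Since T is a ±1-vector this pins every coordinate down: x₀ ≠ 0 iff
-- T(1) = T(t), and x_j ≠ 0 iff T(j) ≠ T(j+1).  Hence (support-formula)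
--   2·|Q(T,R)| = (1 + T(1)T(t)) + Σ_{j ∈ [t-1]} (1 - T(j)T(j+1)).
-- Negating the coordinates in A changes a product T(i)T(k) exactly when
-- one of i, k lies in A, so (support-change), with E = T(1)T(t) if
-- |{1,t} ∩ A| = 1 and E = 0 otherwise, and S the boundary sum,
--   |Q({}_{-A}T,R)| + E = |Q(T,R)| + S,
-- and the theorem is the statement  |Q(T)| = |Q({}_{-A}T)| ⇔ S = E.

open import Defs
open import Data.Nat using (ℕ; suc; _≤_)
open import Data.Bool using (Bool; false)
open import Data.Fin using (Fin; zero; fromℕ)
open import Data.Integer using (ℤ; +_) renaming (_*_ to _*ℤ_)
open import Data.Product using (_×_; ∃)
open import Function.Bundles using (_⇔_)
open import Relation.Binary.PropositionalEquality using (_≡_; _≢_)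

import Data.Nat as ℕ
open import Algebra.Bundles using (AbelianGroup)
import Algebra.Properties.Group as GroupProperties
open import Data.Bool using (true; if_then_else_)
open import Data.Empty using (⊥-elim)
open import Data.Fin using (suc; inject₁)
open import Data.Integer using (-_; -[1+_]) renaming (_+_ to _+ℤ_; _-_ to _-ℤ_)
import Data.Integer.Properties as ℤP
open import Data.Integer.Tactic.RingSolver using (solve-∀)
open import Data.Product using (_,_)
open import Data.Sum using (_⊎_; inj₁; inj₂)
open import Function using (_∘_)
open import Function.Bundles using (mk⇔)
open import Relation.Binary.PropositionalEquality
  using (refl; sym; trans; cong; cong₂; subst; module ≡-Reasoning)

open GroupProperties (AbelianGroup.group ℤP.+-0-abelianGroup)
  using (∙-cancelˡ; ∙-cancelʳ)

Σ-cong : ∀ {n} {f g : Fin n → ℤ} → (∀ i → f i ≡ g i) → Σℤ f ≡ Σℤ g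
Σ-cong {ℕ.zero} p = refl
Σ-cong {suc n}  p = cong₂ _+ℤ_ (p zero) (Σ-cong (p ∘ suc))

Σ-+ : ∀ {n} (f g : Fin n → ℤ) → Σℤ (λ i → f i +ℤ g i) ≡ Σℤ f +ℤ Σℤ g
Σ-+ {ℕ.zero} f g = refl
Σ-+ {suc n}  f g = begin
  (f zero +ℤ g zero) +ℤ Σℤ (λ i → f (suc i) +ℤ g (suc i))
    ≡⟨ cong ((f zero +ℤ g zero) +ℤ_) (Σ-+ (f ∘ suc) (g ∘ suc)) ⟩
  (f zero +ℤ g zero) +ℤ (Σℤ (f ∘ suc) +ℤ Σℤ (g ∘ suc))
    ≡⟨ interchange (f zero) (g zero) (Σℤ (f ∘ suc)) (Σℤ (g ∘ suc)) ⟩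
  (f zero +ℤ Σℤ (f ∘ suc)) +ℤ (g zero +ℤ Σℤ (g ∘ suc)) ∎
  where
  open ≡-Reasoning
  interchange : ∀ a b c d → (a +ℤ b) +ℤ (c +ℤ d) ≡ (a +ℤ c) +ℤ (b +ℤ d)
  interchange = solve-∀

Σ-*ʳ : ∀ {n} (f : Fin n → ℤ) c → Σℤ (λ i → f i *ℤ c) ≡ Σℤ f *ℤ c
Σ-*ʳ {ℕ.zero} f c = refl
Σ-*ʳ {suc n}  f c = trans (cong (f zero *ℤ c +ℤ_) (Σ-*ʳ (f ∘ suc) c))
                          (sym (ℤP.*-distribʳ-+ c (f zero) (Σℤ (f ∘ suc))))

countNonzero-Σ : ∀ {n} (x : Fin n → ℤ) → + countNonzero x ≡ Σℤ (λ j → + nz (x j))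
countNonzero-Σ {ℕ.zero} x = refl
countNonzero-Σ {suc n}  x = trans (ℤP.pos-+ (nz (x zero)) (countNonzero (x ∘ suc)))
                                  (cong (+ nz (x zero) +ℤ_) (countNonzero-Σ (x ∘ suc)))

combination : ∀ {t} → (Fin t → ℤ) → Fin t → ℤ
combination x j = Σℤ (λ s → x s *ℤ Rrow s j)

-- Coordinate 1: every row but R^0 has first entry -1.
combination-first : ∀ n (x : Fin (suc n) → ℤ) →
  combination x zero ≡ x zero -ℤ Σℤ (x ∘ suc)
combination-first n x = cong₂ _+ℤ_ (ℤP.*-identityʳ (x zero)) (begin
  Σℤ (λ s → x (suc s) *ℤ -[1+ 0 ]) ≡⟨ Σ-*ʳ (x ∘ suc) -[1+ 0 ] ⟩
  Σℤ (x ∘ suc) *ℤ -[1+ 0 ]         ≡⟨ ℤP.*-comm (Σℤ (x ∘ suc)) -[1+ 0 ] ⟩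
  -[1+ 0 ] *ℤ Σℤ (x ∘ suc)         ≡⟨ ℤP.-1*i≡-i (Σℤ (x ∘ suc)) ⟩
  - Σℤ (x ∘ suc)                   ∎)
  where open ≡-Reasoning

-- Coordinate t: every row has last entry +1.
combination-last : ∀ n (x : Fin (suc n) → ℤ) → combination x (fromℕ n) ≡ Σℤ x
combination-last ℕ.zero    x = cong (_+ℤ + 0) (ℤP.*-identityʳ (x zero))
combination-last (suc n) x =
  cong₂ _+ℤ_ (ℤP.*-identityʳ (x zero)) (combination-last n (x ∘ suc))

-- Passing from coordinate j to j+1 flips only the entry of row R^j.
combination-step : ∀ n (x : Fin (suc n) → ℤ) (j : Fin n) →
  combination x (suc j) ≡ combination x (inject₁ j) +ℤ + 2 *ℤ x (suc j)
combination-step (suc n) x zero =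
  flip (x zero *ℤ + 1) (x (suc zero)) (Σℤ (λ s → x (suc (suc s)) *ℤ -[1+ 0 ]))
  where
  flip : ∀ p a q → p +ℤ (a *ℤ + 1 +ℤ q) ≡ (p +ℤ (a *ℤ - + 1 +ℤ q)) +ℤ + 2 *ℤ a
  flip = solve-∀
combination-step (suc n) x (suc j) =
  trans (cong (x zero *ℤ + 1 +ℤ_) (combination-step n (x ∘ suc) j))
        (sym (ℤP.+-assoc (x zero *ℤ + 1) (combination (x ∘ suc) (inject₁ j))
                         (+ 2 *ℤ x (suc (suc j)))))

Sign : ℤ → Set
Sign a = (a ≡ + 1) ⊎ (a ≡ -[1+ 0 ])

negate-sign : ∀ b {a} → Sign a → Sign (if b then - a else a)
negate-sign true  (inj₁ refl) = inj₂ refl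
negate-sign true  (inj₂ refl) = inj₁ refl
negate-sign false s           = s

negOn-tope : ∀ {t} A (T : Fin t → ℤ) → IsTope T → IsTope (negOn A T)
negOn-tope A T tope i = negate-sign (A i) (tope i)

sign-step-support : ∀ {a b} c → Sign a → Sign b → b ≡ a +ℤ + 2 *ℤ c →
  + 2 *ℤ + nz c ≡ + 1 -ℤ a *ℤ b
sign-step-support {a} c sa sb step = cases c sa sb (trans step (cong (a +ℤ_) (twice c)))
  where
  twice : ∀ c → + 2 *ℤ c ≡ c +ℤ c
  twice = solve-∀
  cases : ∀ {a b} c → Sign a → Sign b → b ≡ a +ℤ (c +ℤ c) → + 2 *ℤ + nz c ≡ + 1 -ℤ a *ℤ b
  cases (+ ℕ.zero) (inj₁ refl) (inj₁ refl) _  = refl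
  cases (+ ℕ.zero) (inj₂ refl) (inj₂ refl) _  = refl
  cases (+ suc k)  (inj₁ refl) (inj₂ refl) _  = refl
  cases -[1+ k ]   (inj₁ refl) (inj₂ refl) _  = refl
  cases (+ suc k)  (inj₂ refl) (inj₁ refl) _  = refl
  cases -[1+ k ]   (inj₂ refl) (inj₁ refl) _  = refl
  cases (+ suc k)  (inj₁ refl) (inj₁ refl) ()
  cases -[1+ k ]   (inj₁ refl) (inj₁ refl) ()
  cases (+ suc k)  (inj₂ refl) (inj₂ refl) ()
  cases -[1+ k ]   (inj₂ refl) (inj₂ refl) ()
  cases (+ ℕ.zero) (inj₁ refl) (inj₂ refl) ()
  cases (+ ℕ.zero) (inj₂ refl) (inj₁ refl) ()

-- The endpoint version: if two signs sum to 2c, then c ≠ 0 exactly when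
-- they agree; it is the step version applied to -a.
sign-sum-support : ∀ {a b} c → Sign a → Sign b → a +ℤ b ≡ + 2 *ℤ c →
  + 2 *ℤ + nz c ≡ + 1 +ℤ a *ℤ b
sign-sum-support {a} {b} c sa sb sum =
  trans (sign-step-support c (negate-sign true sa) sb (trans (move a b) (cong (- a +ℤ_) sum)))
        (flipSign a b)
  where
  move : ∀ a b → b ≡ - a +ℤ (a +ℤ b)
  move = solve-∀
  flipSign : ∀ a b → + 1 -ℤ (- a) *ℤ b ≡ + 1 +ℤ a *ℤ b
  flipSign = solve-∀

support-formula : ∀ n (T x : Fin (suc n) → ℤ) → IsTope T → IsCoordVec T x →
  + 2 *ℤ + countNonzero x ≡
  (+ 1 +ℤ T zero *ℤ T (fromℕ n)) +ℤ Σℤ (λ j → + 1 -ℤ T (inject₁ j) *ℤ T (suc j))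
support-formula n T x tope coords = begin
  + 2 *ℤ + countNonzero x
    ≡⟨ cong (+ 2 *ℤ_) (countNonzero-Σ x) ⟩
  + 2 *ℤ (+ nz (x zero) +ℤ Σℤ (λ j → + nz (x (suc j))))
    ≡⟨ ℤP.*-distribˡ-+ (+ 2) (+ nz (x zero)) _ ⟩
  + 2 *ℤ + nz (x zero) +ℤ + 2 *ℤ Σℤ (λ j → + nz (x (suc j)))
    ≡⟨ cong (+ 2 *ℤ + nz (x zero) +ℤ_) (ℤP.*-comm (+ 2) _) ⟩
  + 2 *ℤ + nz (x zero) +ℤ Σℤ (λ j → + nz (x (suc j))) *ℤ + 2
    ≡⟨ cong₂ _+ℤ_ endpoints (sym (Σ-*ʳ (λ j → + nz (x (suc j))) (+ 2))) ⟩
  (+ 1 +ℤ T zero *ℤ T (fromℕ n)) +ℤ Σℤ (λ j → + nz (x (suc j)) *ℤ + 2)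
    ≡⟨ cong ((+ 1 +ℤ T zero *ℤ T (fromℕ n)) +ℤ_) (Σ-cong steps) ⟩
  (+ 1 +ℤ T zero *ℤ T (fromℕ n)) +ℤ Σℤ (λ j → + 1 -ℤ T (inject₁ j) *ℤ T (suc j)) ∎
  where
  open ≡-Reasoning
  halves : ∀ a s → (a -ℤ s) +ℤ (a +ℤ s) ≡ + 2 *ℤ a
  halves = solve-∀
  endpoints : + 2 *ℤ + nz (x zero) ≡ + 1 +ℤ T zero *ℤ T (fromℕ n)
  endpoints = sign-sum-support (x zero) (tope zero) (tope (fromℕ n))
    (trans (cong₂ _+ℤ_ (trans (coords zero) (combination-first n x))
                       (trans (coords (fromℕ n)) (combination-last n x)))
           (halves (x zero) (Σℤ (x ∘ suc))))
  steps : ∀ j → + nz (x (suc j)) *ℤ + 2 ≡ + 1 -ℤ T (inject₁ j) *ℤ T (suc j)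
  steps j = trans (ℤP.*-comm (+ nz (x (suc j))) (+ 2))
    (sign-step-support (x (suc j)) (tope (inject₁ j)) (tope (suc j))
      (trans (coords (suc j))
        (trans (combination-step n x j)
               (cong (_+ℤ + 2 *ℤ x (suc j)) (sym (coords (inject₁ j)))))))

ifOne : ℕ → ℤ → ℤ
ifOne 1 z = z
ifOne _ _ = + 0

ifOne-≢1 : ∀ {k} z → k ≢ 1 → ifOne k z ≡ + 0
ifOne-≢1 {ℕ.zero}      z _  = refl
ifOne-≢1 {suc ℕ.zero}  z ne = ⊥-elim (ne refl)
ifOne-≢1 {suc (suc k)} z _  = refl

-- The boundary sum, with its selector replaced by ifOne (the selector of
-- Defs is local to boundarySum, so agreement is shown case by case).
boundarySum-ifOne : ∀ {n} A T → boundarySum {n} A T ≡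
  Σℤ (λ i → ifOne (pairCount A i) (T (inject₁ i) *ℤ T (suc i)))
boundarySum-ifOne {ℕ.zero} A T = refl
boundarySum-ifOne {suc n}  A T with A zero | A (suc zero)
... | true  | true  = cong (+ 0 +ℤ_) (boundarySum-ifOne (A ∘ suc) (T ∘ suc))
... | true  | false = cong (T zero *ℤ T (suc zero) +ℤ_) (boundarySum-ifOne (A ∘ suc) (T ∘ suc))
... | false | true  = cong (T zero *ℤ T (suc zero) +ℤ_) (boundarySum-ifOne (A ∘ suc) (T ∘ suc))
... | false | false = cong (+ 0 +ℤ_) (boundarySum-ifOne (A ∘ suc) (T ∘ suc))

negated-product : ∀ a b u v →
  (if a then - u else u) *ℤ (if b then - v else v) ≡
  u *ℤ v -ℤ + 2 *ℤ ifOne (b2n a ℕ.+ b2n b) (u *ℤ v)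
negated-product true  true  u v = both u v
  where both : ∀ u v → (- u) *ℤ (- v) ≡ u *ℤ v -ℤ + 2 *ℤ + 0
        both = solve-∀
negated-product true  false u v = first u v
  where first : ∀ u v → (- u) *ℤ v ≡ u *ℤ v -ℤ + 2 *ℤ (u *ℤ v)
        first = solve-∀
negated-product false true  u v = second u v
  where second : ∀ u v → u *ℤ (- v) ≡ u *ℤ v -ℤ + 2 *ℤ (u *ℤ v)
        second = solve-∀
negated-product false false u v = neither u v
  where neither : ∀ u v → u *ℤ v ≡ u *ℤ v -ℤ + 2 *ℤ + 0
        neither = solve-∀

pairs-after-negation : ∀ n (A : Subset (suc n)) (T : Fin (suc n) → ℤ) →
  Σℤ (λ j → + 1 -ℤ negOn A T (inject₁ j) *ℤ negOn A T (suc j)) ≡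
  Σℤ (λ j → + 1 -ℤ T (inject₁ j) *ℤ T (suc j)) +ℤ + 2 *ℤ boundarySum A T
pairs-after-negation n A T = begin
  Σℤ (λ j → + 1 -ℤ negOn A T (inject₁ j) *ℤ negOn A T (suc j))
    ≡⟨ Σ-cong (λ j → trans (cong (+ 1 -ℤ_) (negated-product (A (inject₁ j)) (A (suc j)) _ _))
                           (regroup (T (inject₁ j) *ℤ T (suc j)) (σ j))) ⟩
  Σℤ (λ j → (+ 1 -ℤ T (inject₁ j) *ℤ T (suc j)) +ℤ σ j *ℤ + 2)
    ≡⟨ Σ-+ (λ j → + 1 -ℤ T (inject₁ j) *ℤ T (suc j)) (λ j → σ j *ℤ + 2) ⟩
  Σℤ (λ j → + 1 -ℤ T (inject₁ j) *ℤ T (suc j)) +ℤ Σℤ (λ j → σ j *ℤ + 2)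
    ≡⟨ cong (Σℤ (λ j → + 1 -ℤ T (inject₁ j) *ℤ T (suc j)) +ℤ_)
            (trans (Σ-*ʳ σ (+ 2))
                   (trans (ℤP.*-comm (Σℤ σ) (+ 2)) (cong (+ 2 *ℤ_) (sym (boundarySum-ifOne A T))))) ⟩
  Σℤ (λ j → + 1 -ℤ T (inject₁ j) *ℤ T (suc j)) +ℤ + 2 *ℤ boundarySum A T ∎
  where
  open ≡-Reasoning
  σ : Fin n → ℤ
  σ i = ifOne (pairCount A i) (T (inject₁ i) *ℤ T (suc i))
  regroup : ∀ p s → + 1 -ℤ (p -ℤ + 2 *ℤ s) ≡ (+ 1 -ℤ p) +ℤ s *ℤ + 2
  regroup = solve-∀

support-change : ∀ n (T : Fin (suc n) → ℤ) → IsTope T → (A : Subset (suc n)) →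
  (x y : Fin (suc n) → ℤ) → IsCoordVec T x → IsCoordVec (negOn A T) y →
  + countNonzero y +ℤ ifOne (endCount A) (T zero *ℤ T (fromℕ n)) ≡
  + countNonzero x +ℤ boundarySum A T
support-change n T tope A x y coordsT coordsA = ℤP.*-cancelˡ-≡ (+ 2) _ _ (begin
  + 2 *ℤ (+ countNonzero y +ℤ E)
    ≡⟨ ℤP.*-distribˡ-+ (+ 2) (+ countNonzero y) E ⟩
  + 2 *ℤ + countNonzero y +ℤ + 2 *ℤ E
    ≡⟨ cong (_+ℤ + 2 *ℤ E) (support-formula n T' y (negOn-tope A T tope) coordsA) ⟩
  ((+ 1 +ℤ T' zero *ℤ T' (fromℕ n)) +ℤ Pairs') +ℤ + 2 *ℤ E
    ≡⟨ cong₂ (λ e p → ((+ 1 +ℤ e) +ℤ p) +ℤ + 2 *ℤ E)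
             (negated-product (A zero) (A (fromℕ n)) (T zero) (T (fromℕ n)))
             (pairs-after-negation n A T) ⟩
  ((+ 1 +ℤ (z -ℤ + 2 *ℤ E)) +ℤ (Pairs +ℤ + 2 *ℤ S)) +ℤ + 2 *ℤ E
    ≡⟨ regroup z E Pairs S ⟩
  ((+ 1 +ℤ z) +ℤ Pairs) +ℤ + 2 *ℤ S
    ≡⟨ cong (_+ℤ + 2 *ℤ S) (sym (support-formula n T x tope coordsT)) ⟩
  + 2 *ℤ + countNonzero x +ℤ + 2 *ℤ S
    ≡⟨ sym (ℤP.*-distribˡ-+ (+ 2) (+ countNonzero x) S) ⟩
  + 2 *ℤ (+ countNonzero x +ℤ S) ∎)
  where
  open ≡-Reasoning
  T' = negOn A T
  z = T zero *ℤ T (fromℕ n)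
  E = ifOne (endCount A) z
  S = boundarySum A T
  Pairs = Σℤ (λ j → + 1 -ℤ T (inject₁ j) *ℤ T (suc j))
  Pairs' = Σℤ (λ j → + 1 -ℤ T' (inject₁ j) *ℤ T' (suc j))
  regroup : ∀ z E P S → ((+ 1 +ℤ (z -ℤ + 2 *ℤ E)) +ℤ (P +ℤ + 2 *ℤ S)) +ℤ + 2 *ℤ E ≡
                        ((+ 1 +ℤ z) +ℤ P) +ℤ + 2 *ℤ S
  regroup = solve-∀

balance : ∀ {c c'} {E S} → + c' +ℤ E ≡ + c +ℤ S → (c ≡ c') ⇔ (S ≡ E)
balance {c} {c'} {E} {S} eq = mk⇔ sameCount sameCorrection
  where
  sameCount : c ≡ c' → S ≡ E
  sameCount refl = sym (∙-cancelˡ (+ c) E S eq)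
  sameCorrection : S ≡ E → c ≡ c'
  sameCorrection refl = sym (ℤP.+-injective (∙-cancelʳ S (+ c') (+ c) eq))

mainTheorem4 : (n : ℕ) → 3 ≤ suc n →
    (T : Fin (suc n) → ℤ) → IsTope T →
    (A : Subset (suc n)) → ∃ (λ i → A i ≡ false) →
    (x y : Fin (suc n) → ℤ) → IsCoordVec T x → IsCoordVec (negOn A T) y →
    ((endCount A ≡ 1 →
        ((countNonzero x ≡ countNonzero y) ⇔ (boundarySum A T ≡ T zero *ℤ T (fromℕ n))))
    × (endCount A ≢ 1 →
        ((countNonzero x ≡ countNonzero y) ⇔ (boundarySum A T ≡ + 0))))
mainTheorem4 n _ T tope A _ x y coordsT coordsA = oneEnd , notOneEnd
  where
  z = T zero *ℤ T (fromℕ n)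
  general : (countNonzero x ≡ countNonzero y) ⇔ (boundarySum A T ≡ ifOne (endCount A) z)
  general = balance (support-change n T tope A x y coordsT coordsA)
  oneEnd : endCount A ≡ 1 → (countNonzero x ≡ countNonzero y) ⇔ (boundarySum A T ≡ z)
  oneEnd one = subst (λ k → (countNonzero x ≡ countNonzero y) ⇔ (boundarySum A T ≡ ifOne k z))
                     one general
  notOneEnd : endCount A ≢ 1 → (countNonzero x ≡ countNonzero y) ⇔ (boundarySum A T ≡ + 0)
  notOneEnd notOne = subst (λ e → (countNonzero x ≡ countNonzero y) ⇔ (boundarySum A T ≡ e))
                           (ifOne-≢1 z notOne) general
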